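{- For every $n\ge1$, the map $\theta$ sending a collapsed permutation $\pi=\pi_1\cdots\pi_{2n+2}$ of $[2n+2]$ to $\sigma=\sigma_1\cdots\sigma_{2n}$ with $\sigma_{2i-1}=\pi_{n+i+1}-1$ and $\sigma_{2i}=\pi_{i+1}-1$ for $1\le i\le n$ is a bijection from $\mathcal{CO}_{2n+2}$ onto $\mathfrak{D}_{2n}$.
   Context: A permutation $\pi$ of $[2m]$ is collapsed if $1+\lfloor k/2\rfloor\le\pi^{ -1}(k)\le m+\lfloor k/2\rfloor$ for every $k\in[2m]$; $\mathcal{CO}_{2m}$ denotes the set of collapsed permutations of $[2m]$. $\mathfrak{D}_{2n}$ (D-permutations) is the set of permutations $\sigma$ of $[2n]$ with $\sigma_{2i}\le 2i$ and $\sigma_{2i-1}\ge 2i-1$ for all $i\in[n]$. -}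

module Defs where

open import Data.Nat using (ℕ; zero; suc; _+_; _*_; _∸_; _≤_; _<?_)
open import Data.Nat.DivMod using (_/_)
open import Data.Fin using (Fin; toℕ; fromℕ<)
open import Data.Fin.Permutation using (Permutation′; _⟨$⟩ʳ_; _⟨$⟩ˡ_)
open import Data.Product using (_×_)
open import Relation.Nullary using (yes; no)
open import Relation.Binary.PropositionalEquality using (_≡_)

-- Permutations of [N] = {1,…,N} are represented by Permutation′ N (bijections
-- Fin N ↔ Fin N, Fin being 0-based). To match the paper's 1-based notation we
-- read them through the following 1-based accessors on ℕ:
--   at π p    = π_p        (value at 1-based position p, in 1..N)
--   atInv π k = π^{-1}(k)  (1-based position of value k)
-- Both return 0 outside the range 1..N (never used there).

at : {N : ℕ} → Permutation′ N → ℕ → ℕ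
at {N} π zero = 0
at {N} π (suc q) with q <? N
... | yes q<N = suc (toℕ (π ⟨$⟩ʳ fromℕ< q<N))
... | no _ = 0

atInv : {N : ℕ} → Permutation′ N → ℕ → ℕ
atInv {N} π zero = 0
atInv {N} π (suc q) with q <? N
... | yes q<N = suc (toℕ (π ⟨$⟩ˡ fromℕ< q<N))
... | no _ = 0

Collapsed : (m : ℕ) → Permutation′ (2 * m) → Set
Collapsed m π = ∀ k → 1 ≤ k → k ≤ 2 * m →
  (1 + k / 2 ≤ atInv π k) × (atInv π k ≤ m + k / 2)

IsDPerm : (n : ℕ) → Permutation′ (2 * n) → Set
IsDPerm n σ = ∀ i → 1 ≤ i → i ≤ n →
  (at σ (2 * i) ≤ 2 * i) × (2 * i ∸ 1 ≤ at σ (2 * i ∸ 1))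

-- "θ(π) = σ": σ = σ₁⋯σ_{2n} is the image of π (a permutation of
-- [2n+2] = [2*(n+1)]) under θ, i.e. for all 1 ≤ i ≤ n
--   σ_{2i-1} = π_{n+i+1} - 1  and  σ_{2i} = π_{i+1} - 1.
-- (Positions 2i-1, 2i for i ∈ [n] cover all of [2n], so this determines σ.)
θ≡ : (n : ℕ) → Permutation′ (2 * (n + 1)) → Permutation′ (2 * n) → Set
θ≡ n π σ = ∀ i → 1 ≤ i → i ≤ n →
  (at σ (2 * i ∸ 1) ≡ at π (n + i + 1) ∸ 1) × (at σ (2 * i) ≡ at π (i + 1) ∸ 1)

{-# OPTIONS --safe #-}
-- Read at position p with value k = π_p, the collapse condition says ⌈(k-1)/2⌉ ≤ p-1 ≤ n + ⌈(k-1)/2⌉.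
-- At p = 1 and p = 2n+2 it forces π_1 = 1 and π_{2n+2} = 2n+2, so θ merely deletes these two fixed
-- points, lowers the other values by one and relabels the positions 2,…,2n+1 bijectively onto [2n];
-- hence θ is a bijection from the permutations of [2n+2] fixing both ends onto all permutations of [2n].
-- At the remaining positions the condition says exactly σ_{2i} ≤ 2i (at p = i+1) and σ_{2i-1} ≥ 2i-1
-- (at p = n+i+1), and at the two fixed ends it holds trivially, so θ matches CO_{2n+2} with 𝔇_{2n}.

module Submission where

open import Defs
open import Data.Nat
  using (ℕ; zero; suc; pred; _+_; _*_; _∸_; _/_; _≤_; _<_; _<?_; ⌊_/2⌋; ⌈_/2⌉; z≤n; s≤s; s≤s⁻¹; z<s)
open import Data.Nat.Properties
open import Data.Nat.DivMod using (m/n≡1+[m∸n]/n)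
open import Data.Fin using (Fin; toℕ; fromℕ<)
open import Data.Fin.Properties using (toℕ-fromℕ<; fromℕ<-toℕ; toℕ-injective; toℕ<n)
open import Data.Fin.Permutation using (Permutation′; _⟨$⟩ʳ_; _⟨$⟩ˡ_; permutation; inverseˡ; inverseʳ)
open import Data.Product using (Σ-syntax; _×_; _,_; proj₁; proj₂; map)
open import Data.Sum using (inj₁; inj₂)
open import Function.Bundles using (_⇔_; mk⇔; Equivalence)
open import Function.Construct.Composition using (_⇔-∘_)
open import Relation.Nullary using (yes; no)
open import Relation.Nullary.Negation using (contradiction)
open import Relation.Binary.PropositionalEquality

private
  variable
    M N : ℕ

record PermutationBelow (N : ℕ) : Set where
  field
    to from : ℕ → ℕ
    to-<    : ∀ {x} → x < N → to x < N
    from-<  : ∀ {y} → y < N → from y < N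
    to-from : ∀ {y} → y < N → to (from y) ≡ y
    from-to : ∀ {x} → x < N → from (to x) ≡ x

open PermutationBelow

infix 10 _⁻¹
infixr 9 _∘ᴾ_

_⁻¹ : PermutationBelow N → PermutationBelow N
P ⁻¹ = record
  { to = from P ; from = to P ; to-< = from-< P ; from-< = to-< P
  ; to-from = from-to P ; from-to = to-from P }

castᴾ : M ≡ N → PermutationBelow M → PermutationBelow N
castᴾ {M} M≡N P = record
  { to = to P ; from = from P
  ; to-< = λ x<N → M<N (to-< P (N<M x<N)) ; from-< = λ y<N → M<N (from-< P (N<M y<N))
  ; to-from = λ y<N → to-from P (N<M y<N) ; from-to = λ x<N → from-to P (N<M x<N) }
  where
  M<N : ∀ {x} → x < M → x < _
  M<N {x} = subst (x <_) M≡N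
  N<M : ∀ {x} → x < _ → x < M
  N<M {x} = subst (x <_) (sym M≡N)

∘-to-from : (P Q : PermutationBelow N) → ∀ {y} → y < N → to P (to Q (from Q (from P y))) ≡ y
∘-to-from P Q y<N = trans (cong (to P) (to-from Q (from-< P y<N))) (to-from P y<N)

_∘ᴾ_ : PermutationBelow N → PermutationBelow N → PermutationBelow N
P ∘ᴾ Q = record
  { to = λ x → to P (to Q x) ; from = λ y → from Q (from P y)
  ; to-< = λ x<N → to-< P (to-< Q x<N) ; from-< = λ y<N → from-< Q (from-< P y<N)
  ; to-from = ∘-to-from P Q ; from-to = ∘-to-from (Q ⁻¹) (P ⁻¹) }

∀-from⇔∀-to : (P : PermutationBelow N) (R : ℕ → ℕ → Set) →
              (∀ {v} → v < N → R (from P v) v) ⇔ (∀ {x} → x < N → R x (to P x))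
∀-from⇔∀-to P R = mk⇔
  (λ h {x} x<N → subst (λ x′ → R x′ (to P x)) (from-to P x<N) (h (to-< P x<N)))
  (λ h {v} v<N → subst (R (from P v)) (to-from P v<N) (h (from-< P v<N)))

∀<-cast : {Q : ℕ → Set} → M ≡ N → (∀ {x} → x < M → Q x) ⇔ (∀ {x} → x < N → Q x)
∀<-cast refl = mk⇔ (λ h → h) (λ h → h)

∀-toℕ⇒∀-< : {Q : ℕ → Set} → (∀ (j : Fin N) → Q (toℕ j)) → ∀ {x} → x < N → Q x
∀-toℕ⇒∀-< {Q = Q} h x<N = subst Q (toℕ-fromℕ< x<N) (h (fromℕ< x<N))

onℕ : (Fin N → Fin N) → ℕ → ℕ
onℕ {N} f x with x <? N
... | yes x<N = toℕ (f (fromℕ< x<N))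
... | no _    = 0

onℕ-toℕ : (f : Fin N → Fin N) (j : Fin N) → onℕ f (toℕ j) ≡ toℕ (f j)
onℕ-toℕ {N} f j with toℕ j <? N
... | yes j<N = cong (λ i → toℕ (f i)) (fromℕ<-toℕ j j<N)
... | no j≮N  = contradiction (toℕ<n j) j≮N

onℕ-< : (f : Fin N → Fin N) → ∀ {x} → x < N → onℕ f x < N
onℕ-< {N} f = ∀-toℕ⇒∀-< λ j → subst (_< N) (sym (onℕ-toℕ f j)) (toℕ<n (f j))

onℕ-inverse : (f g : Fin N → Fin N) → (∀ {j} → f (g j) ≡ j) →
              ∀ {y} → y < N → onℕ f (onℕ g y) ≡ y
onℕ-inverse f g f∘g≡id = ∀-toℕ⇒∀-< λ j → begin
  onℕ f (onℕ g (toℕ j)) ≡⟨ cong (onℕ f) (onℕ-toℕ g j) ⟩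
  onℕ f (toℕ (g j))     ≡⟨ onℕ-toℕ f (g j) ⟩
  toℕ (f (g j))         ≡⟨ cong toℕ f∘g≡id ⟩
  toℕ j                 ∎
  where open ≡-Reasoning

fromPermutation : Permutation′ N → PermutationBelow N
fromPermutation π = record
  { to = onℕ (π ⟨$⟩ʳ_) ; from = onℕ (π ⟨$⟩ˡ_)
  ; to-< = onℕ-< (π ⟨$⟩ʳ_) ; from-< = onℕ-< (π ⟨$⟩ˡ_)
  ; to-from = onℕ-inverse (π ⟨$⟩ʳ_) (π ⟨$⟩ˡ_) (inverseʳ π)
  ; from-to = onℕ-inverse (π ⟨$⟩ˡ_) (π ⟨$⟩ʳ_) (inverseˡ π) }

onFin : (f : ℕ → ℕ) → (∀ {x} → x < N → f x < N) → Fin N → Fin N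
onFin f f< j = fromℕ< (f< (toℕ<n j))

onFin-inverse : {f g : ℕ → ℕ} (f< : ∀ {x} → x < N → f x < N) (g< : ∀ {x} → x < N → g x < N) →
                (∀ {y} → y < N → f (g y) ≡ y) → ∀ j → onFin f f< (onFin g g< j) ≡ j
onFin-inverse {f = f} {g} f< g< f∘g≡id j = toℕ-injective (begin
  toℕ (onFin f f< (onFin g g< j)) ≡⟨ toℕ-fromℕ< _ ⟩
  f (toℕ (onFin g g< j))          ≡⟨ cong f (toℕ-fromℕ< _) ⟩
  f (g (toℕ j))                  ≡⟨ f∘g≡id (toℕ<n j) ⟩
  toℕ j                           ∎)
  where open ≡-Reasoning

toPermutation : PermutationBelow N → Permutation′ N
toPermutation P = permutation (onFin (to P) (to-< P)) (onFin (from P) (from-< P))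
  (onFin-inverse (to-< P) (from-< P) (to-from P)) (onFin-inverse (from-< P) (to-< P) (from-to P))

record _≃_ (π : Permutation′ N) (P : PermutationBelow N) : Set where
  field
    toℕ-⟨$⟩ʳ : ∀ j → toℕ (π ⟨$⟩ʳ j) ≡ to P (toℕ j)
    toℕ-⟨$⟩ˡ : ∀ j → toℕ (π ⟨$⟩ˡ j) ≡ from P (toℕ j)

open _≃_

≃-fromPermutation : (π : Permutation′ N) → π ≃ fromPermutation π
≃-fromPermutation π = record
  { toℕ-⟨$⟩ʳ = λ j → sym (onℕ-toℕ (π ⟨$⟩ʳ_) j)
  ; toℕ-⟨$⟩ˡ = λ j → sym (onℕ-toℕ (π ⟨$⟩ˡ_) j) }

≃-toPermutation : (P : PermutationBelow N) → toPermutation P ≃ P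
≃-toPermutation P = record
  { toℕ-⟨$⟩ʳ = λ _ → toℕ-fromℕ< _ ; toℕ-⟨$⟩ˡ = λ _ → toℕ-fromℕ< _ }

at-toℕ : (π : Permutation′ N) (j : Fin N) → at π (suc (toℕ j)) ≡ suc (toℕ (π ⟨$⟩ʳ j))
at-toℕ {N} π j with toℕ j <? N
... | yes j<N = cong (λ i → suc (toℕ (π ⟨$⟩ʳ i))) (fromℕ<-toℕ j j<N)
... | no j≮N  = contradiction (toℕ<n j) j≮N

atInv-toℕ : (π : Permutation′ N) (j : Fin N) → atInv π (suc (toℕ j)) ≡ suc (toℕ (π ⟨$⟩ˡ j))
atInv-toℕ {N} π j with toℕ j <? N
... | yes j<N = cong (λ i → suc (toℕ (π ⟨$⟩ˡ i))) (fromℕ<-toℕ j j<N)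
... | no j≮N  = contradiction (toℕ<n j) j≮N

module _ {π : Permutation′ N} {P : PermutationBelow N} (π≃P : π ≃ P) where

  at≡ : ∀ {x} → x < N → at π (suc x) ≡ suc (to P x)
  at≡ = ∀-toℕ⇒∀-< λ j → trans (at-toℕ π j) (cong suc (toℕ-⟨$⟩ʳ π≃P j))

  atInv≡ : ∀ {x} → x < N → atInv π (suc x) ≡ suc (from P x)
  atInv≡ = ∀-toℕ⇒∀-< λ j → trans (atInv-toℕ π j) (cong suc (toℕ-⟨$⟩ˡ π≃P j))

≃-agree : {π π′ : Permutation′ N} {P P′ : PermutationBelow N} → π ≃ P → π′ ≃ P′ →
          (∀ {x} → x < N → to P x ≡ to P′ x) → ∀ j → π ⟨$⟩ʳ j ≡ π′ ⟨$⟩ʳ j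
≃-agree π≃P π′≃P′ P≗P′ j =
  toℕ-injective (trans (toℕ-⟨$⟩ʳ π≃P j) (trans (P≗P′ (toℕ<n j)) (sym (toℕ-⟨$⟩ʳ π′≃P′ j))))

data Bracketed (N : ℕ) : ℕ → Set where
  first : Bracketed N 0
  inner : ∀ {q} → q < N → Bracketed N (suc q)
  last  : Bracketed N (suc N)

bracketed : ∀ {x} → x < 2 + N → Bracketed N x
bracketed {x = zero}  _              = first
bracketed {x = suc q} (s≤s q<1+N) with m<1+n⇒m<n∨m≡n q<1+N
... | inj₁ q<N  = inner q<N
... | inj₂ refl = last

suc-inner-< : ∀ {q} → q < N → suc q < 2 + N
suc-inner-< q<N = s≤s (m<n⇒m<1+n q<N)

FixesEnds : ℕ → (ℕ → ℕ) → Set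
FixesEnds N f = f 0 ≡ 0 × f (suc N) ≡ suc N

extendFun : ℕ → (ℕ → ℕ) → ℕ → ℕ
extendFun N f zero = zero
extendFun N f (suc q) with q <? N
... | yes _ = suc (f q)
... | no _  = suc q

module _ {f : ℕ → ℕ} where

  extendFun-inner : ∀ {q} → q < N → extendFun N f (suc q) ≡ suc (f q)
  extendFun-inner {N} {q} q<N with q <? N
  ... | yes _   = refl
  ... | no q≮N = contradiction q<N q≮N

  extendFun-last : extendFun N f (suc N) ≡ suc N
  extendFun-last {N} with N <? N
  ... | yes N<N = contradiction N<N (<-irrefl refl)
  ... | no _    = refl

  extendFun-< : (∀ {q} → q < N → f q < N) → ∀ {x} → x < 2 + N → extendFun N f x < 2 + N
  extendFun-< {N} f< x< with bracketed x<
  ... | first     = z<s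
  ... | inner q<N = subst (_< 2 + N) (sym (extendFun-inner q<N)) (suc-inner-< (f< q<N))
  ... | last      = subst (_< 2 + N) (sym extendFun-last) ≤-refl

extendFun-inverse : {f g : ℕ → ℕ} → (∀ {y} → y < N → g y < N) → (∀ {y} → y < N → f (g y) ≡ y) →
                    ∀ {x} → x < 2 + N → extendFun N f (extendFun N g x) ≡ x
extendFun-inverse {N} {f} {g} g< f∘g≡id x< with bracketed x<
... | first     = refl
... | inner q<N = begin
  extendFun N f (extendFun N g (suc _)) ≡⟨ cong (extendFun N f) (extendFun-inner q<N) ⟩
  extendFun N f (suc (g _))             ≡⟨ extendFun-inner (g< q<N) ⟩
  suc (f (g _))                         ≡⟨ cong suc (f∘g≡id q<N) ⟩
  suc _                                 ∎
  where open ≡-Reasoning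
... | last      = trans (cong (extendFun N f) extendFun-last) extendFun-last

extend : PermutationBelow N → PermutationBelow (2 + N)
extend P = record
  { to = extendFun _ (to P) ; from = extendFun _ (from P)
  ; to-< = extendFun-< (to-< P) ; from-< = extendFun-< (from-< P)
  ; to-from = extendFun-inverse (from-< P) (to-from P)
  ; from-to = extendFun-inverse (to-< P) (from-to P) }

FixesEnds-extend : (P : PermutationBelow N) → FixesEnds N (to (extend P))
FixesEnds-extend P = refl , extendFun-last

module _ (P : PermutationBelow (2 + N)) where

  FixesEnds-from : FixesEnds N (to P) → FixesEnds N (from P)
  FixesEnds-from (to0 , toN) =
      trans (cong (from P) (sym to0)) (from-to P z<s)
    , trans (cong (from P) (sym toN)) (from-to P ≤-refl)

  preimage-inner : FixesEnds N (from P) → ∀ {q v} → q < N → from P v ≡ suc q → Bracketed N v →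
                   v ≡ suc (pred v) × pred v < N
  preimage-inner (from0 , _) _   v↦q first       = contradiction (trans (sym from0) v↦q) λ ()
  preimage-inner (_ , fromN) q<N v↦q last        =
    contradiction (suc-injective (trans (sym v↦q) fromN)) (<⇒≢ q<N)
  preimage-inner _           _   _   (inner w<N) = refl , w<N

  to-inner : FixesEnds N (to P) → ∀ {q} → q < N →
             to P (suc q) ≡ suc (pred (to P (suc q))) × pred (to P (suc q)) < N
  to-inner ends q<N = preimage-inner (FixesEnds-from ends) q<N (from-to P (suc-inner-< q<N))
                        (bracketed (to-< P (suc-inner-< q<N)))

interior-to-from : (P : PermutationBelow (2 + N)) → FixesEnds N (from P) →
                   ∀ {y} → y < N → pred (to P (suc (pred (from P (suc y))))) ≡ y
interior-to-from P ends y<N =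
  cong pred (trans (cong (to P) (sym (proj₁ (to-inner (P ⁻¹) ends y<N)))) (to-from P (suc-inner-< y<N)))

interior : (P : PermutationBelow (2 + N)) → FixesEnds N (to P) → PermutationBelow N
interior P ends = record
  { to = λ q → pred (to P (suc q)) ; from = λ q → pred (from P (suc q))
  ; to-< = λ q<N → proj₂ (to-inner P ends q<N)
  ; from-< = λ q<N → proj₂ (to-inner (P ⁻¹) (FixesEnds-from P ends) q<N)
  ; to-from = interior-to-from P (FixesEnds-from P ends)
  ; from-to = interior-to-from (P ⁻¹) ends }

2*n≡n+n : ∀ n → 2 * n ≡ n + n
2*n≡n+n n = cong (n +_) (+-identityʳ n)

2*[n+1]≡2+2*n : ∀ n → 2 * (n + 1) ≡ 2 + 2 * n
2*[n+1]≡2+2*n n = trans (cong (2 *_) (+-comm n 1)) (*-suc 2 n)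

1+2*a<2*n : ∀ {a n} → a < n → suc (2 * a) < 2 * n
1+2*a<2*n {a} {n} a<n = subst (_≤ 2 * n) (*-suc 2 a) (*-monoʳ-≤ 2 a<n)

n+a<2*n : ∀ {a n} → a < n → n + a < 2 * n
n+a<2*n {a} {n} a<n = subst (n + a <_) (sym (2*n≡n+n n)) (+-monoʳ-< n a<n)

a<2*n : ∀ {a n} → a < n → a < 2 * n
a<2*n {n = n} a<n = ≤-trans a<n (m≤m+n n _)

data Parity : ℕ → Set where
  even : ∀ a → Parity (2 * a)
  odd  : ∀ a → Parity (suc (2 * a))

parity : ∀ x → Parity x
parity zero = even 0
parity (suc zero) = odd 0
parity (suc (suc x)) with parity x
... | even a = subst Parity (*-suc 2 a) (even (suc a))
... | odd a  = subst (λ y → Parity (suc y)) (*-suc 2 a) (odd (suc a))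

data Halves (n : ℕ) : ℕ → Set where
  left  : ∀ {a} → a < n → Halves n a
  right : ∀ {a} → a < n → Halves n (n + a)

halves : ∀ n {q} → q < 2 * n → Halves n q
halves n {q} q<2n with q <? n
... | yes q<n = left q<n
... | no q≮n  = subst (Halves n) n+[q∸n]≡q (right (+-cancelˡ-< n (q ∸ n) n n+[q∸n]<n+n))
  where
  n+[q∸n]≡q = m+[n∸m]≡n (≮⇒≥ q≮n)
  n+[q∸n]<n+n = subst₂ _<_ (sym n+[q∸n]≡q) (2*n≡n+n n) q<2n

-- θ's relabelling of positions, 0-based: π's positions 2,…,n+1 go to σ's even positions 2i and
-- n+2,…,2n+1 to the odd positions 2i-1 (that is, to 2i-1 and 2i-2 counted from 0).
interleave : ℕ → ℕ → ℕ
interleave n q with q <? n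
... | yes _ = suc (2 * q)
... | no _  = 2 * (q ∸ n)

deinterleave : ℕ → ℕ → ℕ
deinterleave n zero          = n
deinterleave n (suc zero)    = zero
deinterleave n (suc (suc x)) = suc (deinterleave n x)

interleave-left : ∀ {n a} → a < n → interleave n a ≡ suc (2 * a)
interleave-left {n} {a} a<n with a <? n
... | yes _   = refl
... | no a≮n = contradiction a<n a≮n

interleave-right : ∀ n a → interleave n (n + a) ≡ 2 * a
interleave-right n a with n + a <? n
... | yes n+a<n = contradiction n+a<n (m+n≮m n a)
... | no _      = cong (2 *_) (m+n∸m≡n n a)

deinterleave-odd : ∀ n a → deinterleave n (suc (2 * a)) ≡ a
deinterleave-odd n zero    = refl
deinterleave-odd n (suc a) =
  trans (cong (λ y → deinterleave n (suc y)) (*-suc 2 a)) (cong suc (deinterleave-odd n a))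

deinterleave-even : ∀ n a → deinterleave n (2 * a) ≡ n + a
deinterleave-even n zero    = sym (+-identityʳ n)
deinterleave-even n (suc a) = begin
  deinterleave n (2 * suc a)     ≡⟨ cong (deinterleave n) (*-suc 2 a) ⟩
  suc (deinterleave n (2 * a))  ≡⟨ cong suc (deinterleave-even n a) ⟩
  suc (n + a)                   ≡⟨ +-suc n a ⟨
  n + suc a                     ∎
  where open ≡-Reasoning

module _ (n : ℕ) where

  private
    half-< : ∀ {a} → 2 * a < 2 * n → a < n
    half-< {a} = *-cancelˡ-< 2 a n

  interleave-< : ∀ {q} → q < 2 * n → interleave n q < 2 * n
  interleave-< q<2n with halves n q<2n
  ... | left a<n  = subst (_< 2 * n) (sym (interleave-left a<n)) (1+2*a<2*n a<n)
  ... | right a<n = subst (_< 2 * n) (sym (interleave-right n _)) (*-monoʳ-< 2 a<n)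

  deinterleave-< : ∀ {x} → x < 2 * n → deinterleave n x < 2 * n
  deinterleave-< {x} x<2n with parity x
  ... | even a = subst (_< 2 * n) (sym (deinterleave-even n a)) (n+a<2*n (half-< x<2n))
  ... | odd a  = subst (_< 2 * n) (sym (deinterleave-odd n a)) (a<2*n (half-< (<-trans (n<1+n _) x<2n)))

  interleave-deinterleave : ∀ {x} → x < 2 * n → interleave n (deinterleave n x) ≡ x
  interleave-deinterleave {x} x<2n with parity x
  ... | even a = trans (cong (interleave n) (deinterleave-even n a)) (interleave-right n a)
  ... | odd a  = trans (cong (interleave n) (deinterleave-odd n a))
                       (interleave-left (half-< (<-trans (n<1+n _) x<2n)))

  deinterleave-interleave : ∀ {q} → q < 2 * n → deinterleave n (interleave n q) ≡ q
  deinterleave-interleave q<2n with halves n q<2n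
  ... | left {a} a<n  = trans (cong (deinterleave n) (interleave-left a<n)) (deinterleave-odd n a)
  ... | right {a} a<n = trans (cong (deinterleave n) (interleave-right n a)) (deinterleave-even n a)

  interleaving : PermutationBelow (2 * n)
  interleaving = record
    { to = interleave n ; from = deinterleave n
    ; to-< = interleave-< ; from-< = deinterleave-<
    ; to-from = interleave-deinterleave ; from-to = deinterleave-interleave }

n/2≡⌊n/2⌋ : ∀ n → n / 2 ≡ ⌊ n /2⌋
n/2≡⌊n/2⌋ zero          = refl
n/2≡⌊n/2⌋ (suc zero)    = refl
n/2≡⌊n/2⌋ (suc (suc n)) =
  trans (m/n≡1+[m∸n]/n {suc (suc n)} {2} (s≤s (s≤s z≤n))) (cong suc (n/2≡⌊n/2⌋ n))

⌊2*n/2⌋≡n : ∀ n → ⌊ 2 * n /2⌋ ≡ n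
⌊2*n/2⌋≡n n = sym (trans (n≡⌊n+n/2⌋ n) (cong ⌊_/2⌋ (sym (2*n≡n+n n))))

⌊1+2*n/2⌋≡n : ∀ n → ⌊ suc (2 * n) /2⌋ ≡ n
⌊1+2*n/2⌋≡n n = sym (trans (n≡⌈n+n/2⌉ n) (cong ⌈_/2⌉ (sym (2*n≡n+n n))))

m≤⌊n/2⌋⇔2*m≤n : ∀ {m n} → m ≤ ⌊ n /2⌋ ⇔ 2 * m ≤ n
m≤⌊n/2⌋⇔2*m≤n {m} {n} =
  mk⇔ double-≤ (λ 2m≤n → subst (_≤ ⌊ n /2⌋) (⌊2*n/2⌋≡n m) (⌊n/2⌋-mono 2m≤n))
  where
  open ≤-Reasoning
  double-≤ : m ≤ ⌊ n /2⌋ → 2 * m ≤ n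
  double-≤ m≤n/2 = begin
    2 * m               ≡⟨ 2*n≡n+n m ⟩
    m + m               ≤⟨ +-mono-≤ m≤n/2 m≤n/2 ⟩
    ⌊ n /2⌋ + ⌊ n /2⌋   ≤⟨ +-monoʳ-≤ ⌊ n /2⌋ (⌊n/2⌋≤⌈n/2⌉ n) ⟩
    ⌊ n /2⌋ + ⌈ n /2⌉   ≡⟨ ⌊n/2⌋+⌈n/2⌉≡n n ⟩
    n                   ∎

⌊n/2⌋≤m⇔n≤1+2*m : ∀ {m n} → ⌊ n /2⌋ ≤ m ⇔ n ≤ suc (2 * m)
⌊n/2⌋≤m⇔n≤1+2*m {m} {n} = mk⇔
  (λ n/2≤m → ≮⇒≥ λ 1+2m<n →
     <⇒≱ (Equivalence.from m≤⌊n/2⌋⇔2*m≤n (subst (_≤ n) (sym (*-suc 2 m)) 1+2m<n)) n/2≤m)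
  (λ n≤1+2m → subst (⌊ n /2⌋ ≤_) (⌊1+2*n/2⌋≡n m) (⌊n/2⌋-mono n≤1+2m))

-- CollapsedAt c x v is the collapse condition in CO_{2c+2} for the value v+1 at the position x+1;
-- the names marked ᴺ below are likewise 0-based transcriptions of the definitions in Defs.
CollapsedAt : ℕ → ℕ → ℕ → Set
CollapsedAt c x v = ⌈ v /2⌉ ≤ x × x ≤ c + ⌈ v /2⌉

module _ {c : ℕ} where

  CollapsedAt-first : ∀ {v} → CollapsedAt c 0 v → v ≡ 0
  CollapsedAt-first {zero}  _       = refl
  CollapsedAt-first {suc v} (() , _)

  CollapsedAt-last : ∀ {v} → CollapsedAt c (suc (2 * c)) v → v ≤ suc (2 * c) → v ≡ suc (2 * c)
  CollapsedAt-last {v} (_ , 1+2c≤c+⌈v/2⌉) v≤1+2c = ≤-antisym v≤1+2c (s≤s⁻¹ 2+2c≤1+v)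
    where
    1+2c≡c+[1+c] : suc (2 * c) ≡ c + suc c
    1+2c≡c+[1+c] = trans (cong suc (2*n≡n+n c)) (sym (+-suc c c))
    1+c≤⌈v/2⌉ : suc c ≤ ⌈ v /2⌉
    1+c≤⌈v/2⌉ =
      +-cancelˡ-≤ c (suc c) ⌈ v /2⌉ (subst (_≤ c + ⌈ v /2⌉) 1+2c≡c+[1+c] 1+2c≤c+⌈v/2⌉)
    2+2c≤1+v : 2 + 2 * c ≤ suc v
    2+2c≤1+v = subst (_≤ suc v) (*-suc 2 c) (Equivalence.to m≤⌊n/2⌋⇔2*m≤n 1+c≤⌈v/2⌉)

  CollapsedAt-last-fixed : CollapsedAt c (suc (2 * c)) (suc (2 * c))
  CollapsedAt-last-fixed rewrite ⌊2*n/2⌋≡n c =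
    s≤s (m≤m+n c _) , ≤-reflexive (trans (cong suc (2*n≡n+n c)) (sym (+-suc c c)))

  CollapsedAt-left⇔ : ∀ {a w} → a < c → CollapsedAt c (suc a) (suc w) ⇔ w ≤ suc (2 * a)
  CollapsedAt-left⇔ {a} a<c = mk⇔
    (λ (⌈w+1/2⌉≤a+1 , _) → Equivalence.to ⌊n/2⌋≤m⇔n≤1+2*m (s≤s⁻¹ ⌈w+1/2⌉≤a+1))
    (λ w≤1+2a → s≤s (Equivalence.from ⌊n/2⌋≤m⇔n≤1+2*m w≤1+2a) , ≤-trans a<c (m≤m+n c _))

  CollapsedAt-right⇔ : ∀ {a w} → w < 2 * c → CollapsedAt c (suc (c + a)) (suc w) ⇔ 2 * a ≤ w
  CollapsedAt-right⇔ {a} {w} w<2c = mk⇔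
    (λ (_ , u) → Equivalence.to m≤⌊n/2⌋⇔2*m≤n
                   (+-cancelˡ-≤ c a ⌊ w /2⌋ (s≤s⁻¹ (subst (suc (c + a) ≤_) (+-suc c _) u))))
    (λ 2a≤w → s≤s (≤-trans ⌊w/2⌋≤c (m≤m+n c a))
            , subst (suc (c + a) ≤_) (sym (+-suc c _))
                (s≤s (+-monoʳ-≤ c (Equivalence.from m≤⌊n/2⌋⇔2*m≤n 2a≤w))))
    where
    ⌊w/2⌋≤c : ⌊ w /2⌋ ≤ c
    ⌊w/2⌋≤c = Equivalence.from ⌊n/2⌋≤m⇔n≤1+2*m (≤-trans (<⇒≤ w<2c) (n≤1+n _))

Collapsedᴺ : ℕ → (ℕ → ℕ) → Set
Collapsedᴺ c f = ∀ {x} → x < 2 + 2 * c → CollapsedAt c x (f x)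

IsDPermᴺ : ℕ → (ℕ → ℕ) → Set
IsDPermᴺ n f = ∀ {a} → a < n → f (suc (2 * a)) ≤ suc (2 * a) × 2 * a ≤ f (2 * a)

θ≡ᴺ : ℕ → (ℕ → ℕ) → (ℕ → ℕ) → Set
θ≡ᴺ n f g = ∀ {a} → a < n → f (suc (n + a)) ≡ suc (g (2 * a)) × f (suc a) ≡ suc (g (suc (2 * a)))

1-based⇔0-based : {A B : ℕ → Set} → (∀ {a} → a < N → A (suc a) ⇔ B a) →
                  (∀ i → 1 ≤ i → i ≤ N → A i) ⇔ (∀ {a} → a < N → B a)
1-based⇔0-based A⇔B = mk⇔
  (λ h {a} a<N → Equivalence.to (A⇔B a<N) (h (suc a) (s≤s z≤n) a<N))
  (λ { h zero () _ ; h (suc a) _ a<N → Equivalence.from (A⇔B a<N) (h a<N) })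

collapsed-pointwise : ∀ {c v p t} → t ≡ suc p →
                      ((1 + suc v / 2 ≤ t) × (t ≤ c + 1 + suc v / 2)) ⇔ CollapsedAt c p v
collapsed-pointwise {c} {v} refl
  rewrite n/2≡⌊n/2⌋ (suc v) | +-assoc c 1 ⌊ suc v /2⌋ | +-suc c ⌊ suc v /2⌋ =
  mk⇔ (map s≤s⁻¹ s≤s⁻¹) (map s≤s s≤s)

IsDPerm-pointwise : ∀ {a s t s′ t′} → t ≡ suc s → t′ ≡ suc s′ →
                    ((t ≤ 2 * suc a) × (2 * suc a ∸ 1 ≤ t′)) ⇔ ((s ≤ suc (2 * a)) × (2 * a ≤ s′))
IsDPerm-pointwise {a} {s} {s′ = s′} refl refl =
  subst (λ m → ((suc s ≤ m) × (m ∸ 1 ≤ suc s′)) ⇔ ((s ≤ suc (2 * a)) × (2 * a ≤ s′)))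
    (sym (*-suc 2 a)) (mk⇔ (map s≤s⁻¹ s≤s⁻¹) (map s≤s s≤s))

Collapsed⇔Collapsedᴺ : ∀ c {π : Permutation′ (2 * (c + 1))} {P} → π ≃ P →
                       Collapsed (c + 1) π ⇔ Collapsedᴺ c (to P)
Collapsed⇔Collapsedᴺ c {π} {P} π≃P =
      ∀<-cast (2*[n+1]≡2+2*n c)
  ⇔-∘ (∀-from⇔∀-to P (CollapsedAt c)
  ⇔-∘ 1-based⇔0-based (λ v< → collapsed-pointwise (atInv≡ π≃P v<)))

module _ {n} {σ : Permutation′ (2 * n)} {S : PermutationBelow (2 * n)} (σ≃S : σ ≃ S) {a} (a<n : a < n) where

  at-2i-1≡ : at σ (2 * suc a ∸ 1) ≡ suc (to S (2 * a))
  at-2i-1≡ = trans (cong (λ m → at σ (m ∸ 1)) (*-suc 2 a)) (at≡ σ≃S (*-monoʳ-< 2 a<n))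

  at-2i≡ : at σ (2 * suc a) ≡ suc (to S (suc (2 * a)))
  at-2i≡ = trans (cong (at σ) (*-suc 2 a)) (at≡ σ≃S (1+2*a<2*n a<n))

IsDPerm⇔IsDPermᴺ : ∀ n {σ : Permutation′ (2 * n)} {S} → σ ≃ S → IsDPerm n σ ⇔ IsDPermᴺ n (to S)
IsDPerm⇔IsDPermᴺ n σ≃S =
  1-based⇔0-based λ a<n → IsDPerm-pointwise (at-2i≡ σ≃S a<n) (at-2i-1≡ σ≃S a<n)

θ≡-pointwise : ∀ {s₁ s₂ t₁ t₂ p₁ p₂ u₁ u₂} → t₁ ≡ suc s₁ → t₂ ≡ suc s₂ → u₁ ≡ suc p₁ → u₂ ≡ suc p₂ →
               ((t₁ ≡ u₁ ∸ 1) × (t₂ ≡ u₂ ∸ 1)) ⇔ ((p₁ ≡ suc s₁) × (p₂ ≡ suc s₂))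
θ≡-pointwise refl refl refl refl = mk⇔ (map sym sym) (map sym sym)

θ≡⇔θ≡ᴺ : ∀ n {π : Permutation′ (2 * (n + 1))} {σ : Permutation′ (2 * n)} {P S} → π ≃ P → σ ≃ S →
         θ≡ n π σ ⇔ θ≡ᴺ n (to P) (to S)
θ≡⇔θ≡ᴺ n {π} π≃P σ≃S = 1-based⇔0-based λ {a} a<n →
  θ≡-pointwise (at-2i-1≡ σ≃S a<n) (at-2i≡ σ≃S a<n)
    (trans (cong (at π) (trans (+-comm (n + suc a) 1) (cong suc (+-suc n a)))) (at≡ π≃P (suc-< (n+a<2*n a<n))))
    (trans (cong (at π) (+-comm (suc a) 1)) (at≡ π≃P (suc-< (a<2*n a<n))))
  where
  suc-< : ∀ {q} → q < 2 * n → suc q < 2 * (n + 1)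
  suc-< {q} q<2n = subst (suc q <_) (sym (2*[n+1]≡2+2*n n)) (suc-inner-< q<2n)

θᴺ : ∀ n (P : PermutationBelow (2 + 2 * n)) → FixesEnds (2 * n) (to P) → PermutationBelow (2 * n)
θᴺ n P ends = interior P ends ∘ᴾ interleaving n ⁻¹

θ≡ᴺ-θᴺ : ∀ n (P : PermutationBelow (2 + 2 * n)) (ends : FixesEnds (2 * n) (to P)) →
         θ≡ᴺ n (to P) (to (θᴺ n P ends))
θ≡ᴺ-θᴺ n P ends {a} a<n =
    trans (proj₁ (to-inner P ends (n+a<2*n a<n))) (cong (interior-at) (sym (deinterleave-even n a)))
  , trans (proj₁ (to-inner P ends (a<2*n a<n))) (cong (interior-at) (sym (deinterleave-odd n a)))
  where
  interior-at : ℕ → ℕ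
  interior-at q = suc (pred (to P (suc q)))

θ⁻¹ᴺ : ∀ n → PermutationBelow (2 * n) → PermutationBelow (2 + 2 * n)
θ⁻¹ᴺ n S = extend (S ∘ᴾ interleaving n)

θ≡ᴺ-θ⁻¹ᴺ : ∀ n (S : PermutationBelow (2 * n)) → θ≡ᴺ n (to (θ⁻¹ᴺ n S)) (to S)
θ≡ᴺ-θ⁻¹ᴺ n S {a} a<n =
    trans (extendFun-inner (n+a<2*n a<n)) (cong (λ x → suc (to S x)) (interleave-right n a))
  , trans (extendFun-inner (a<2*n a<n)) (cong (λ x → suc (to S x)) (interleave-left a<n))

θ≡ᴺ-unique : ∀ n {f f′ g} → FixesEnds (2 * n) f → FixesEnds (2 * n) f′ → θ≡ᴺ n f g → θ≡ᴺ n f′ g →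
             ∀ {x} → x < 2 + 2 * n → f x ≡ f′ x
θ≡ᴺ-unique n (f0 , fN) (f′0 , f′N) θ θ′ x< with bracketed x<
... | first      = trans f0 (sym f′0)
... | last       = trans fN (sym f′N)
... | inner q<2n with halves n q<2n
...   | left a<n  = trans (proj₂ (θ a<n)) (sym (proj₂ (θ′ a<n)))
...   | right a<n = trans (proj₁ (θ a<n)) (sym (proj₁ (θ′ a<n)))

Collapsedᴺ⇒FixesEnds : ∀ c (P : PermutationBelow (2 + 2 * c)) → Collapsedᴺ c (to P) →
                       FixesEnds (2 * c) (to P)
Collapsedᴺ⇒FixesEnds c P col =
  CollapsedAt-first (col z<s) , CollapsedAt-last (col ≤-refl) (s≤s⁻¹ (to-< P ≤-refl))

Collapsedᴺ⇔IsDPermᴺ : ∀ n (f : ℕ → ℕ) (S : PermutationBelow (2 * n)) →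
                      FixesEnds (2 * n) f → θ≡ᴺ n f (to S) →
                      Collapsedᴺ n f ⇔ IsDPermᴺ n (to S)
Collapsedᴺ⇔IsDPermᴺ n f S (f0 , fN) θ = mk⇔ collapsed⇒D D⇒collapsed
  where
  odd⇔ : ∀ {a} → a < n → CollapsedAt n (suc a) (f (suc a)) ⇔ (to S (suc (2 * a)) ≤ suc (2 * a))
  odd⇔ a<n = subst (λ v → CollapsedAt n _ v ⇔ _) (sym (proj₂ (θ a<n))) (CollapsedAt-left⇔ a<n)

  even⇔ : ∀ {a} → a < n → CollapsedAt n (suc (n + a)) (f (suc (n + a))) ⇔ (2 * a ≤ to S (2 * a))
  even⇔ a<n = subst (λ v → CollapsedAt n _ v ⇔ _) (sym (proj₁ (θ a<n)))
                (CollapsedAt-right⇔ (to-< S (*-monoʳ-< 2 a<n)))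

  collapsed⇒D : Collapsedᴺ n f → IsDPermᴺ n (to S)
  collapsed⇒D col a<n = Equivalence.to (odd⇔ a<n) (col (suc-inner-< (a<2*n a<n)))
                      , Equivalence.to (even⇔ a<n) (col (suc-inner-< (n+a<2*n a<n)))

  D⇒collapsed : IsDPermᴺ n (to S) → Collapsedᴺ n f
  D⇒collapsed D x< with bracketed x<
  ... | first      = subst (CollapsedAt n 0) (sym f0) (z≤n , z≤n)
  ... | last       = subst (CollapsedAt n _) (sym fN) CollapsedAt-last-fixed
  ... | inner q<2n with halves n q<2n
  ...   | left a<n  = Equivalence.from (odd⇔ a<n) (proj₁ (D a<n))
  ...   | right a<n = Equivalence.from (even⇔ a<n) (proj₂ (D a<n))

θ-image : ∀ n (π : Permutation′ (2 * (n + 1))) → Collapsed (n + 1) π →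
          Σ[ σ ∈ Permutation′ (2 * n) ] (θ≡ n π σ × IsDPerm n σ)
θ-image n π col =
    toPermutation S
  , Equivalence.from (θ≡⇔θ≡ᴺ n π≃P σ≃S) θ≡S
  , Equivalence.from (IsDPerm⇔IsDPermᴺ n σ≃S) (Equivalence.to (Collapsedᴺ⇔IsDPermᴺ n (to P) S ends θ≡S) colᴺ)
  where
  π≃P = ≃-fromPermutation π
  P = castᴾ (2*[n+1]≡2+2*n n) (fromPermutation π)
  colᴺ = Equivalence.to (Collapsed⇔Collapsedᴺ n π≃P) col
  ends = Collapsedᴺ⇒FixesEnds n P colᴺ
  S = θᴺ n P ends
  σ≃S = ≃-toPermutation S
  θ≡S = θ≡ᴺ-θᴺ n P ends

θ-injective : ∀ n (π π′ : Permutation′ (2 * (n + 1))) (σ : Permutation′ (2 * n)) →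
              Collapsed (n + 1) π → Collapsed (n + 1) π′ → θ≡ n π σ → θ≡ n π′ σ →
              ∀ j → π ⟨$⟩ʳ j ≡ π′ ⟨$⟩ʳ j
θ-injective n π π′ σ col col′ θ θ′ =
  ≃-agree π≃P π′≃P′ λ {x} x< →
    θ≡ᴺ-unique n {to P} {to P′} {to S} (ends P π≃P col) (ends P′ π′≃P′ col′)
      (Equivalence.to (θ≡⇔θ≡ᴺ n π≃P σ≃S) θ) (Equivalence.to (θ≡⇔θ≡ᴺ n π′≃P′ σ≃S) θ′)
      (subst (x <_) (2*[n+1]≡2+2*n n) x<)
  where
  P = fromPermutation π
  P′ = fromPermutation π′
  S = fromPermutation σ
  π≃P = ≃-fromPermutation π
  π′≃P′ = ≃-fromPermutation π′
  σ≃S = ≃-fromPermutation σ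
  ends : ∀ {ρ} (R : PermutationBelow (2 * (n + 1))) → ρ ≃ R → Collapsed (n + 1) ρ →
         FixesEnds (2 * n) (to R)
  ends R ρ≃R col =
    Collapsedᴺ⇒FixesEnds n (castᴾ (2*[n+1]≡2+2*n n) R) (Equivalence.to (Collapsed⇔Collapsedᴺ n ρ≃R) col)

θ-surjective : ∀ n (σ : Permutation′ (2 * n)) → IsDPerm n σ →
               Σ[ π ∈ Permutation′ (2 * (n + 1)) ] (Collapsed (n + 1) π × θ≡ n π σ)
θ-surjective n σ D =
    toPermutation P
  , Equivalence.from (Collapsed⇔Collapsedᴺ n π≃P) (Equivalence.from (Collapsedᴺ⇔IsDPermᴺ n (to P) S ends θ≡P) Dᴺ)
  , Equivalence.from (θ≡⇔θ≡ᴺ n π≃P σ≃S) θ≡P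
  where
  S = fromPermutation σ
  σ≃S = ≃-fromPermutation σ
  Dᴺ = Equivalence.to (IsDPerm⇔IsDPermᴺ n σ≃S) D
  ends = FixesEnds-extend (S ∘ᴾ interleaving n)
  P = castᴾ (sym (2*[n+1]≡2+2*n n)) (θ⁻¹ᴺ n S)
  π≃P = ≃-toPermutation P
  θ≡P = θ≡ᴺ-θ⁻¹ᴺ n S

theorem4p4 : (n : ℕ) → 1 ≤ n →
    ((π : Permutation′ (2 * (n + 1))) → Collapsed (n + 1) π →
      Σ[ σ ∈ Permutation′ (2 * n) ] (θ≡ n π σ × IsDPerm n σ))
    × ((π π′ : Permutation′ (2 * (n + 1))) (σ : Permutation′ (2 * n)) →
      Collapsed (n + 1) π → Collapsed (n + 1) π′ → θ≡ n π σ → θ≡ n π′ σ →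
      ∀ j → π ⟨$⟩ʳ j ≡ π′ ⟨$⟩ʳ j)
    × ((σ : Permutation′ (2 * n)) → IsDPerm n σ →
      Σ[ π ∈ Permutation′ (2 * (n + 1)) ] (Collapsed (n + 1) π × θ≡ n π σ))
theorem4p4 n _ = θ-image n , θ-injective n , θ-surjective n
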